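{- Every provably recursive function of $\mathbf{BA}$ is primitive recursive, i.e. $\mathrm{PR}(\mathbf{BA})\subseteq\mathcal{PR}$. Furthermore every function in $\mathrm{PR}(\mathbf{BA})$ is defined in $\mathbf{BA}$ by some $\exists_1^+$ formula.
   Context: Language and formulas: the arithmetic language is $\mathcal L=\{0,S,+,\cdot\}$; $s<t$ abbreviates $\exists x(s+Sx=t)$ ($x$ fresh). Formulas of basic logic are built from atomic formulas (equations, $\top$, $\bot$) using $\land,\lor,\exists x$, and the universal-implication former $\forall\mathbf x(A\to B)$ for a finite (possibly empty) sequence $\mathbf x$ of variables (empty $\mathbf x$ gives implication $A\to B$; $\neg A$ is $A\to\bot$). Theories prove sequents $A\Rightarrow B$. Basic Predicate Calculus $\mathbf{BQC}$ has axioms: $A\Rightarrow A$; $A\Rightarrow\top$; $\bot\Rightarrow A$; $A\land(B\lor C)\Rightarrow(A\land B)\lor(A\land C)$; $A\land\exists xB\Rightarrow\exists x(A\land B)$ ($x$ not free in $A$); $\top\Rightarrow x=x$; $x=y\land A\Rightarrow A[x/y]$ ($A$ atomic); $\forall\mathbf x(A\to B)\land\forall\mathbf x(B\to C)\Rightarrow\forall\mathbf x(A\to C)$; $\forall\mathbf x(A\to B)\land\forall\mathbf x(A\to C)\Rightarrow\forall\mathbf x(A\to B\land C)$; $\forall\mathbf x(B\to A)\land\forall\mathbf x(C\to A)\Rightarrow\forall\mathbf x(B\lor C\to A)$; $\forall\mathbf x(A\to B)\Rightarrow\forall\mathbf x(A[\mathbf x/\mathbf t]\to B[\mathbf x/\mathbf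 t])$; $\forall\mathbf x(A\to B)\Rightarrow\forall\mathbf y(A\to B)$ (no variable of $\mathbf y$ free on the left); $\forall\mathbf yx(B\to A)\Rightarrow\forall\mathbf y(\exists xB\to A)$ ($x$ not free in $A$); rules: transitivity of $\Rightarrow$; $A\Rightarrow B\land C$ iff $A\Rightarrow B$ and $A\Rightarrow C$; $B\lor C\Rightarrow A$ iff $B\Rightarrow A$ and $C\Rightarrow A$; substitution of terms; $\exists xB\Rightarrow A$ iff $B\Rightarrow A$ ($x$ not free in $A$); from $A\land B\Rightarrow C$ infer $A\Rightarrow\forall\mathbf x(B\to C)$ (no variable of $\mathbf x$ free in $A$). $\mathbf{BA}$ is $\mathbf{BQC}$ plus $Sx=0\Rightarrow\bot$, $Sx=Sy\Rightarrow x=y$, $x+0=x$, $x+Sy=S(x+y)$, $x\cdot0=0$, $x\cdot Sy=x\cdot y+x$, the induction axiom schema $\forall\mathbf yx(A\to A[x/Sx])\Rightarrow\forall\mathbf yx(A[x/0]\to A)$ and the induction rule (from $A\Rightarrow A[x/Sx]$ infer $A[x/0]\Rightarrow A$). $\Delta_0$: smallest class containing atomic formulas and closed under $\land,\lor,\to$ and bounded quantifiers $\exists x(x<s\land A)$, $\forall x(x<s\to A)$; $\Sigma_1$: formulas $\exists\mathbf xA$ with $A\in\Delta_0$; $\exists_1^+$: formulas $\exists\mathbf xA$ with $A$ quantifier-free without $\to$. A formula $A(\mathbf x,y)$ defines $f:\mathbb N^n\to\mathbb N$ in a theory $T$ if $\mathbb N\models A(\mathbf a,b)\iff f(\mathbf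 a)=b$ for all $\mathbf a,b$, and $T$ proves $\top\Rightarrow\exists yA(\mathbf x,y)$ and $A(\mathbf x,u)\land A(\mathbf x,v)\Rightarrow u=v$. $\mathrm{PR}(T)$ is the set of functions defined in $T$ by a $\Sigma_1$ formula; $\mathcal{PR}$ is the class of primitive recursive functions. -}

module Defs where

open import Data.Nat using (ℕ; zero; suc; _+_)
open import Data.Fin using (Fin; zero; suc; _↑ˡ_; _↑ʳ_; splitAt; _≟_)
open import Data.Vec using (Vec; []; _∷_; lookup; _++_)
open import Data.Sum using (_⊎_; inj₁; inj₂)
open import Data.Product using (Σ; _×_; _,_)
open import Data.Unit using (⊤)
open import Data.Empty using (⊥)
open import Relation.Nullary using (yes; no)
open import Relation.Binary.PropositionalEquality using (_≡_)
open import Function.Bundles using (_⇔_)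

data Tm (n : ℕ) : Set where
  var  : Fin n → Tm n
  `0   : Tm n
  `S   : Tm n → Tm n
  _`+_ : Tm n → Tm n → Tm n
  _`·_ : Tm n → Tm n → Tm n

-- Formulas of basic logic.  ∀'[ k ] A ⇒ B is the universal implication
-- ∀x₁…x_k (A → B); the k bound variables are the indices  j ↑ˡ n  (j : Fin k)
-- of Fm (k + n), the outer variables are  k ↑ʳ i.
data Fm (n : ℕ) : Set where
  _≐_     : Tm n → Tm n → Fm n
  ⊤'      : Fm n
  ⊥'      : Fm n
  _∧'_    : Fm n → Fm n → Fm n
  _∨'_    : Fm n → Fm n → Fm n
  ∃'      : Fm (suc n) → Fm n
  ∀'[_]_⇒_ : (k : ℕ) → Fm (k + n) → Fm (k + n) → Fm n

infix  6 _≐_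
infixr 5 _∧'_
infixr 4 _∨'_

Sub : ℕ → ℕ → Set
Sub m n = Fin m → Tm n

tsub : ∀ {m n} → Sub m n → Tm m → Tm n
tsub σ (var i)  = σ i
tsub σ `0       = `0
tsub σ (`S t)   = `S (tsub σ t)
tsub σ (s `+ t) = tsub σ s `+ tsub σ t
tsub σ (s `· t) = tsub σ s `· tsub σ t

wkt : ∀ {n} k → Tm n → Tm (k + n)
wkt k = tsub (λ i → var (k ↑ʳ i))

lift : ∀ {m n} k → Sub m n → Sub (k + m) (k + n)
lift {m} {n} k σ i with splitAt k i
... | inj₁ j = var (j ↑ˡ n)
... | inj₂ j = wkt k (σ j)

fsub : ∀ {m n} → Sub m n → Fm m → Fm n
fsub σ (s ≐ t)          = tsub σ s ≐ tsub σ t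
fsub σ ⊤'               = ⊤'
fsub σ ⊥'               = ⊥'
fsub σ (A ∧' B)         = fsub σ A ∧' fsub σ B
fsub σ (A ∨' B)         = fsub σ A ∨' fsub σ B
fsub σ (∃' A)           = ∃' (fsub (lift 1 σ) A)
fsub σ (∀'[ k ] A ⇒ B)  = ∀'[ k ] fsub (lift k σ) A ⇒ fsub (lift k σ) B

-- weakening of formulas by k fresh variables in front ("x not free in A")
wkf : ∀ {n} k → Fm n → Fm (k + n)
wkf k = fsub (λ i → var (k ↑ʳ i))

sub1 : ∀ {n} → Fin n → Tm n → Sub n n
sub1 x t i with x ≟ i
... | yes _ = t
... | no  _ = var i

rebind : ∀ {n} k m → (Fin k → Tm (m + n)) → Sub (k + n) (m + n)
rebind k m ts i with splitAt k i
... | inj₁ j = ts j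
... | inj₂ j = var (m ↑ʳ j)

data Atomic {n : ℕ} : Fm n → Set where
  at-eq : ∀ s t → Atomic (s ≐ t)
  at-⊤  : Atomic ⊤'
  at-⊥  : Atomic ⊥'

-- The theory BA (= BQC + arithmetic axioms + induction), sequents A ⇒ B
-- over a scope n (free variables of the sequent).

data BA : {n : ℕ} → Fm n → Fm n → Set where
  ax-id    : ∀ {n} {A : Fm n} → BA A A
  ax-⊤     : ∀ {n} {A : Fm n} → BA A ⊤'
  ax-⊥     : ∀ {n} {A : Fm n} → BA ⊥' A
  ax-dist  : ∀ {n} {A B C : Fm n} → BA (A ∧' (B ∨' C)) ((A ∧' B) ∨' (A ∧' C))
  ax-frob  : ∀ {n} {A : Fm n} {B : Fm (suc n)} → BA (A ∧' ∃' B) (∃' (wkf 1 A ∧' B))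
  ax-refl  : ∀ {n} (x : Fin n) → BA ⊤' (var x ≐ var x)
  ax-eq    : ∀ {n} (x y : Fin n) {A : Fm n} → Atomic A →
             BA ((var x ≐ var y) ∧' A) (fsub (sub1 x (var y)) A)
  ax-∀tr   : ∀ {n} k {A B C : Fm (k + n)} →
             BA ((∀'[ k ] A ⇒ B) ∧' (∀'[ k ] B ⇒ C)) (∀'[ k ] A ⇒ C)
  ax-∀∧    : ∀ {n} k {A B C : Fm (k + n)} →
             BA ((∀'[ k ] A ⇒ B) ∧' (∀'[ k ] A ⇒ C)) (∀'[ k ] A ⇒ (B ∧' C))
  ax-∀∨    : ∀ {n} k {A B C : Fm (k + n)} →
             BA ((∀'[ k ] B ⇒ A) ∧' (∀'[ k ] C ⇒ A)) (∀'[ k ] (B ∨' C) ⇒ A)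
  -- combines  ∀x(A→B) ⇒ ∀x(A[x/t]→B[x/t])  and  ∀x(A→B) ⇒ ∀y(A→B)
  ax-∀sub  : ∀ {n} k m (ts : Fin k → Tm (m + n)) {A B : Fm (k + n)} →
             BA (∀'[ k ] A ⇒ B)
                (∀'[ m ] fsub (rebind k m ts) A ⇒ fsub (rebind k m ts) B)
  ax-∀∃    : ∀ {n} m {B : Fm (suc (m + n))} {A : Fm (m + n)} →
             BA (∀'[ suc m ] B ⇒ wkf 1 A) (∀'[ m ] ∃' B ⇒ A)
  r-trans  : ∀ {n} {A B C : Fm n} → BA A B → BA B C → BA A C
  r-∧I     : ∀ {n} {A B C : Fm n} → BA A B → BA A C → BA A (B ∧' C)
  r-∧E₁    : ∀ {n} {A B C : Fm n} → BA A (B ∧' C) → BA A B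
  r-∧E₂    : ∀ {n} {A B C : Fm n} → BA A (B ∧' C) → BA A C
  r-∨E     : ∀ {n} {A B C : Fm n} → BA B A → BA C A → BA (B ∨' C) A
  r-∨I₁    : ∀ {n} {A B C : Fm n} → BA (B ∨' C) A → BA B A
  r-∨I₂    : ∀ {n} {A B C : Fm n} → BA (B ∨' C) A → BA C A
  r-subst  : ∀ {m n} (σ : Sub m n) {A B : Fm m} → BA A B → BA (fsub σ A) (fsub σ B)
  r-∃E     : ∀ {n} {A : Fm n} {B : Fm (suc n)} → BA B (wkf 1 A) → BA (∃' B) A
  r-∃E⁻    : ∀ {n} {A : Fm n} {B : Fm (suc n)} → BA (∃' B) A → BA B (wkf 1 A)
  r-→I     : ∀ {n} k {A : Fm n} {B C : Fm (k + n)} →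
             BA (wkf k A ∧' B) C → BA A (∀'[ k ] B ⇒ C)
  ax-S≢0   : ∀ {n} (x : Fin n) → BA (`S (var x) ≐ `0) ⊥'
  ax-Sinj  : ∀ {n} (x y : Fin n) → BA (`S (var x) ≐ `S (var y)) (var x ≐ var y)
  ax-+0    : ∀ {n} (x : Fin n) → BA ⊤' (var x `+ `0 ≐ var x)
  ax-+S    : ∀ {n} (x y : Fin n) → BA ⊤' (var x `+ `S (var y) ≐ `S (var x `+ var y))
  ax-·0    : ∀ {n} (x : Fin n) → BA ⊤' (var x `· `0 ≐ `0)
  ax-·S    : ∀ {n} (x y : Fin n) → BA ⊤' (var x `· `S (var y) ≐ (var x `· var y) `+ var x)
  -- induction axiom schema ∀yx(A → A[x/Sx]) ⇒ ∀yx(A[x/0] → A), x = bound index 0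
  ax-ind   : ∀ {n} m (A : Fm (suc (m + n))) →
             BA (∀'[ suc m ] A ⇒ fsub (sub1 zero (`S (var zero))) A)
                (∀'[ suc m ] fsub (sub1 zero `0) A ⇒ A)
  r-ind    : ∀ {n} (x : Fin n) {A : Fm n} →
             BA A (fsub (sub1 x (`S (var x))) A) → BA (fsub (sub1 x `0) A) A

⟦_⟧t : ∀ {n} → Tm n → Vec ℕ n → ℕ
⟦ var i ⟧t  ρ = lookup ρ i
⟦ `0 ⟧t     ρ = 0
⟦ `S t ⟧t   ρ = suc (⟦ t ⟧t ρ)
⟦ s `+ t ⟧t ρ = ⟦ s ⟧t ρ + ⟦ t ⟧t ρ
⟦ s `· t ⟧t ρ = ⟦ s ⟧t ρ Data.Nat.* ⟦ t ⟧t ρ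

⟦_⟧ : ∀ {n} → Fm n → Vec ℕ n → Set
⟦ s ≐ t ⟧         ρ = ⟦ s ⟧t ρ ≡ ⟦ t ⟧t ρ
⟦ ⊤' ⟧            ρ = ⊤
⟦ ⊥' ⟧            ρ = ⊥
⟦ A ∧' B ⟧        ρ = ⟦ A ⟧ ρ × ⟦ B ⟧ ρ
⟦ A ∨' B ⟧        ρ = ⟦ A ⟧ ρ ⊎ ⟦ B ⟧ ρ
⟦ ∃' A ⟧          ρ = Σ ℕ λ a → ⟦ A ⟧ (a ∷ ρ)
⟦ ∀'[ k ] A ⇒ B ⟧ ρ = (v : Vec ℕ k) → ⟦ A ⟧ (v ++ ρ) → ⟦ B ⟧ (v ++ ρ)

_≺_ : ∀ {n} → Tm n → Tm n → Fm n
s ≺ t = ∃' (wkt 1 s `+ `S (var zero) ≐ wkt 1 t)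

data Δ₀ {n : ℕ} : Fm n → Set where
  d-atom : ∀ {A} → Atomic A → Δ₀ A
  d-∧    : ∀ {A B} → Δ₀ A → Δ₀ B → Δ₀ (A ∧' B)
  d-∨    : ∀ {A B} → Δ₀ A → Δ₀ B → Δ₀ (A ∨' B)
  d-→    : ∀ {A B} → Δ₀ A → Δ₀ B → Δ₀ (∀'[ 0 ] A ⇒ B)
  d-b∃   : ∀ (s : Tm n) {A : Fm (suc n)} → Δ₀ A → Δ₀ (∃' ((var zero ≺ wkt 1 s) ∧' A))
  d-b∀   : ∀ (s : Tm n) {A : Fm (suc n)} → Δ₀ A → Δ₀ (∀'[ 1 ] (var zero ≺ wkt 1 s) ⇒ A)

data QF⁺ {n : ℕ} : Fm n → Set where
  q-atom : ∀ {A} → Atomic A → QF⁺ A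
  q-∧    : ∀ {A B} → QF⁺ A → QF⁺ B → QF⁺ (A ∧' B)
  q-∨    : ∀ {A B} → QF⁺ A → QF⁺ B → QF⁺ (A ∨' B)

∃ⁿ : ∀ {n} k → Fm (k + n) → Fm n
∃ⁿ zero    A = A
∃ⁿ (suc k) A = ∃ⁿ k (∃' A)

Σ₁ : ∀ {n} → Fm n → Set
Σ₁ {n} A = Σ ℕ λ k → Σ (Fm (k + n)) λ B → Δ₀ B × (A ≡ ∃ⁿ k B)

∃₁⁺ : ∀ {n} → Fm n → Set
∃₁⁺ {n} A = Σ ℕ λ k → Σ (Fm (k + n)) λ B → QF⁺ B × (A ≡ ∃ⁿ k B)

-- Definability.  A : Fm (suc n) is read as A(x₁,…,x_n,y) with
-- y = var zero and x_i = var (suc i).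

-- A(x,u) and A(x,v) in scope n+2, u = var 0, v = var 1
σu σv : ∀ {n} → Sub (suc n) (suc (suc n))
σu zero    = var zero
σu (suc i) = var (suc (suc i))
σv zero    = var (suc zero)
σv (suc i) = var (suc (suc i))

Defines : ∀ n → Fm (suc n) → (Vec ℕ n → ℕ) → Set
Defines n A f =
  ((as : Vec ℕ n) (b : ℕ) → ⟦ A ⟧ (b ∷ as) ⇔ (f as ≡ b)) ×
  BA ⊤' (∃' A) ×
  BA (fsub σu A ∧' fsub σv A) (var zero ≐ var (suc zero))

InPR-BA : ∀ n → (Vec ℕ n → ℕ) → Set
InPR-BA n f = Σ (Fm (suc n)) λ A → Σ₁ A × Defines n A f

data PRF : ℕ → Set where
  Z  : ∀ {n} → PRF n
  Sc : PRF 1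
  P  : ∀ {n} → Fin n → PRF n
  C  : ∀ {m n} → PRF m → Vec (PRF n) m → PRF n
  R  : ∀ {n} → PRF n → PRF (suc (suc n)) → PRF (suc n)

mutual
  eval : ∀ {n} → PRF n → Vec ℕ n → ℕ
  eval Z       xs = 0
  eval Sc      (x ∷ []) = suc x
  eval (P i)   xs = lookup xs i
  eval (C g hs) xs = eval g (evalV hs xs)
  eval (R g h) (zero  ∷ xs) = eval g xs
  eval (R g h) (suc y ∷ xs) = eval h (eval (R g h) (y ∷ xs) ∷ y ∷ xs)

  evalV : ∀ {m n} → Vec (PRF n) m → Vec ℕ n → Vec ℕ m
  evalV []       xs = []
  evalV (h ∷ hs) xs = eval h xs ∷ evalV hs xs

IsPR : ∀ n → (Vec ℕ n → ℕ) → Set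
IsPR n f = Σ (PRF n) λ c → (xs : Vec ℕ n) → eval c xs ≡ f xs

-- A number r realizes an equation when the equation is true, a conjunction when the
-- components of the Cantor pair r realize the conjuncts, a disjunction when r tags a
-- realizer of one disjunct, ∃x A when r pairs a witness with a realizer of A, and a
-- universal implication always: no rule of BA extracts a formula other than an
-- implication from an implication, so implications need no computational content.
-- Every rule of BA then transforms realizers by a primitive recursive function, the
-- induction rule by primitive recursion on the induction variable. Applied to the
-- totality sequent ⊤ ⇒ ∃y A(x,y) this computes primitive recursively a realized value
-- of y, and the realized uniqueness sequent forces that value to be f(x). Erasing all
-- universal implications (replacing them by ⊤) maps BA-derivations to BA-derivations,
-- and the erased formula is BA-equivalent to an ∃₁⁺ formula, which by the same
-- realizability argument still defines f.

module Submission where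

open import Defs
open import Data.Nat using (ℕ; zero; suc; _+_; _*_; _∸_; _≤_; _<_; pred; z≤n; s≤s; z<s)
open import Data.Nat.Properties
  using ( ≤-reflexive; ≤-trans; ≤-antisym; ≮⇒≥; ≤⇒≯; m≤m+n; m<m+n; m≤n⇒m≤1+n; +-mono-≤; +-monoʳ-<
        ; m∸n≡0⇒m≤n; m∸n≢0⇒n<m; m+n∸m≡n; pred[m∸n]≡m∸[1+n]; 0≢1+n; suc-injective
        ; +-identityʳ; +-suc; +-comm; *-zeroʳ; *-suc )
open import Data.Fin using (Fin; zero; suc; _≟_)
open import Data.Vec using (Vec; []; _∷_; head; tail; lookup; tabulate; _[_]≔_)
open import Data.Vec.Properties
  using (tabulate∘lookup; lookup∘tabulate; tabulate-cong; lookup∘update; lookup∘update′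
        ; []≔-idempotent; []≔-lookup)
open import Data.Product using (Σ; _×_; _,_; proj₁; proj₂)
open import Data.Sum using (_⊎_; inj₁; inj₂)
open import Data.Unit using (⊤; tt)
open import Data.Empty using (⊥)
open import Relation.Nullary using (yes; no)
open import Relation.Binary.PropositionalEquality
open import Function.Bundles using (_⇔_; mk⇔; Equivalence)
import Function.Properties.Equivalence as ⇔
open import Data.Product.Function.NonDependent.Propositional using (_×-⇔_)
open import Data.Sum.Function.Propositional using (_⊎-⇔_)

private
  variable
    m n : ℕ

IsPRs : ∀ n m → (Vec ℕ n → Vec ℕ m) → Set
IsPRs n m h = ∀ i → IsPR n (λ xs → lookup (h xs) i)

IsPR-cong : {f g : Vec ℕ n → ℕ} → (∀ xs → f xs ≡ g xs) → IsPR n f → IsPR n g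
IsPR-cong f≗g (c , c≗f) = c , λ xs → trans (c≗f xs) (f≗g xs)

IsPR-zero : IsPR n (λ _ → 0)
IsPR-zero = Z , λ _ → refl

IsPR-lookup : (i : Fin n) → IsPR n (λ xs → lookup xs i)
IsPR-lookup i = P i , λ _ → refl

IsPR-head : IsPR (suc n) head
IsPR-head = IsPR-cong (λ { (_ ∷ _) → refl }) (IsPR-lookup zero)

evalV-tabulate : (cs : Fin m → PRF n) (xs : Vec ℕ n) →
                 evalV (tabulate cs) xs ≡ tabulate (λ i → eval (cs i) xs)
evalV-tabulate {zero}  cs xs = refl
evalV-tabulate {suc m} cs xs = cong (eval (cs zero) xs ∷_) (evalV-tabulate (λ i → cs (suc i)) xs)

IsPR-∘ : {g : Vec ℕ m → ℕ} {h : Vec ℕ n → Vec ℕ m} →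
         IsPR m g → IsPRs n m h → IsPR n (λ xs → g (h xs))
IsPR-∘ {h = h} (c , c≗g) ps =
  C c (tabulate (λ i → proj₁ (ps i))) , λ xs → trans (cong (eval c) (args≗h xs)) (c≗g (h xs))
  where
  args≗h : ∀ xs → evalV (tabulate (λ i → proj₁ (ps i))) xs ≡ h xs
  args≗h xs = begin
    evalV (tabulate (λ i → proj₁ (ps i))) xs ≡⟨ evalV-tabulate _ xs ⟩
    tabulate (λ i → eval (proj₁ (ps i)) xs)  ≡⟨ tabulate-cong (λ i → proj₂ (ps i) xs) ⟩
    tabulate (lookup (h xs))                 ≡⟨ tabulate∘lookup (h xs) ⟩
    h xs                                     ∎
    where open ≡-Reasoning

IsPRs-∷ : {f : Vec ℕ n → ℕ} {h : Vec ℕ n → Vec ℕ m} →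
          IsPR n f → IsPRs n m h → IsPRs n (suc m) (λ xs → f xs ∷ h xs)
IsPRs-∷ p ps zero    = p
IsPRs-∷ p ps (suc i) = ps i

IsPRs-[] : IsPRs n 0 (λ _ → [])
IsPRs-[] ()

tail-isPR : IsPRs (suc n) n tail
tail-isPR i = IsPR-cong (λ { (_ ∷ _) → refl }) (IsPR-lookup (suc i))

IsPR-∘tail : {f : Vec ℕ n → ℕ} → IsPR n f → IsPR (suc n) (λ xs → f (tail xs))
IsPR-∘tail p = IsPR-∘ p tail-isPR

IsPR-rec : {g : Vec ℕ n → ℕ} {h : Vec ℕ (suc (suc n)) → ℕ} →
           IsPR n g → IsPR (suc (suc n)) h →
           (f : Vec ℕ (suc n) → ℕ) → (∀ xs → f (0 ∷ xs) ≡ g xs) →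
           (∀ y xs → f (suc y ∷ xs) ≡ h (f (y ∷ xs) ∷ y ∷ xs)) → IsPR (suc n) f
IsPR-rec {h = h} (cg , cg≗g) (ch , ch≗h) f f-zero f-suc = R cg ch , R≗f
  where
  R≗f : ∀ xs → eval (R cg ch) xs ≡ f xs
  R≗f (zero  ∷ xs) = trans (cg≗g xs) (sym (f-zero xs))
  R≗f (suc y ∷ xs) = begin
    eval ch (eval (R cg ch) (y ∷ xs) ∷ y ∷ xs)
      ≡⟨ cong (λ v → eval ch (v ∷ y ∷ xs)) (R≗f (y ∷ xs)) ⟩
    eval ch (f (y ∷ xs) ∷ y ∷ xs)
      ≡⟨ ch≗h _ ⟩
    h (f (y ∷ xs) ∷ y ∷ xs)
      ≡⟨ sym (f-suc y xs) ⟩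
    f (suc y ∷ xs)
      ∎
    where open ≡-Reasoning

record PR₁ (g : ℕ → ℕ) : Set where
  constructor pr₁
  field isPR₁ : IsPR 1 (λ xs → g (head xs))

record PR₂ (g : ℕ → ℕ → ℕ) : Set where
  constructor pr₂
  field isPR₂ : IsPR 2 (λ xs → g (head xs) (head (tail xs)))

record PR₃ (g : ℕ → ℕ → ℕ → ℕ) : Set where
  constructor pr₃
  field isPR₃ : IsPR 3 (λ xs → g (head xs) (head (tail xs)) (head (tail (tail xs))))

IsPR-app₁ : {g : ℕ → ℕ} {f₁ : Vec ℕ n → ℕ} →
            PR₁ g → IsPR n f₁ → IsPR n (λ xs → g (f₁ xs))
IsPR-app₁ {f₁ = f₁} (pr₁ pg) p₁ = IsPR-∘ {h = λ xs → f₁ xs ∷ []} pg (IsPRs-∷ p₁ IsPRs-[])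

IsPR-app₂ : {g : ℕ → ℕ → ℕ} {f₁ f₂ : Vec ℕ n → ℕ} → PR₂ g → IsPR n f₁ → IsPR n f₂ →
            IsPR n (λ xs → g (f₁ xs) (f₂ xs))
IsPR-app₂ {f₁ = f₁} {f₂} (pr₂ pg) p₁ p₂ =
  IsPR-∘ {h = λ xs → f₁ xs ∷ f₂ xs ∷ []} pg (IsPRs-∷ p₁ (IsPRs-∷ p₂ IsPRs-[]))

IsPR-app₃ : {g : ℕ → ℕ → ℕ → ℕ} {f₁ f₂ f₃ : Vec ℕ n → ℕ} → PR₃ g →
            IsPR n f₁ → IsPR n f₂ → IsPR n f₃ → IsPR n (λ xs → g (f₁ xs) (f₂ xs) (f₃ xs))
IsPR-app₃ {f₁ = f₁} {f₂} {f₃} (pr₃ pg) p₁ p₂ p₃ =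
  IsPR-∘ {h = λ xs → f₁ xs ∷ f₂ xs ∷ f₃ xs ∷ []} pg (IsPRs-∷ p₁ (IsPRs-∷ p₂ (IsPRs-∷ p₃ IsPRs-[])))

IsPR-second : IsPR (suc (suc n)) (λ xs → head (tail xs))
IsPR-second = IsPR-∘tail IsPR-head

IsPR-third : IsPR (suc (suc (suc n))) (λ xs → head (tail (tail xs)))
IsPR-third = IsPR-∘tail IsPR-second

PR-suc : PR₁ suc
PR-suc = pr₁ (Sc , λ { (_ ∷ []) → refl })

IsPR-const : ∀ c → IsPR n (λ _ → c)
IsPR-const zero    = IsPR-zero
IsPR-const (suc c) = IsPR-app₁ PR-suc (IsPR-const c)

PR-pred : PR₁ pred
PR-pred = pr₁ (IsPR-rec IsPR-zero IsPR-second _ (λ _ → refl) (λ _ _ → refl))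

PR-+ : PR₂ _+_
PR-+ = pr₂ (IsPR-rec IsPR-head (IsPR-app₁ PR-suc IsPR-head) _ (λ _ → refl) (λ _ _ → refl))

PR-* : PR₂ _*_
PR-* = pr₂ (IsPR-rec IsPR-zero (IsPR-app₂ PR-+ IsPR-third IsPR-head) _
                    (λ _ → refl) (λ _ _ → refl))

PR-∸ : PR₂ _∸_
PR-∸ = pr₂ (IsPR-app₂ PR-flipped-∸ IsPR-second IsPR-head)
  where
  PR-flipped-∸ : PR₂ (λ y x → x ∸ y)
  PR-flipped-∸ = pr₂ (IsPR-rec IsPR-head (IsPR-app₁ PR-pred IsPR-head) _ (λ _ → refl)
                               (λ y xs → sym (pred[m∸n]≡m∸[1+n] (head xs) y)))

ifZero : ℕ → ℕ → ℕ → ℕ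
ifZero zero    a b = a
ifZero (suc _) a b = b

ifZero-zero : ∀ {t a b} → t ≡ 0 → ifZero t a b ≡ a
ifZero-zero refl = refl

ifZero-one : ∀ {t a b} → t ≡ 1 → ifZero t a b ≡ b
ifZero-one refl = refl

PR-ifZero : PR₃ ifZero
PR-ifZero = pr₃ (IsPR-rec IsPR-head (IsPR-∘tail IsPR-third) _ (λ _ → refl) (λ _ _ → refl))

IsPR-⟦⟧t : (t : Tm n) → IsPR n ⟦ t ⟧t
IsPR-⟦⟧t (var i)  = IsPR-lookup i
IsPR-⟦⟧t `0       = IsPR-zero
IsPR-⟦⟧t (`S t)   = IsPR-app₁ PR-suc (IsPR-⟦⟧t t)
IsPR-⟦⟧t (s `+ t) = IsPR-app₂ PR-+ (IsPR-⟦⟧t s) (IsPR-⟦⟧t t)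
IsPR-⟦⟧t (s `· t) = IsPR-app₂ PR-* (IsPR-⟦⟧t s) (IsPR-⟦⟧t t)

IsPRs-[]≔ : ∀ (x : Fin n) {ρ : Vec ℕ m → Vec ℕ n} {a : Vec ℕ m → ℕ} →
            IsPRs m n ρ → IsPR m a → IsPRs m n (λ xs → ρ xs [ x ]≔ a xs)
IsPRs-[]≔ x {ρ} {a} pρ pa i with x ≟ i
... | yes refl = IsPR-cong (λ xs → sym (lookup∘update x (ρ xs) (a xs))) pa
... | no x≢i   = IsPR-cong (λ xs → sym (lookup∘update′ (≢-sym x≢i) (ρ xs) (a xs))) (pρ i)

-- Cantor pairing

tri : ℕ → ℕ
tri zero    = 0
tri (suc s) = tri s + suc s

pair : ℕ → ℕ → ℕ
pair a b = tri (a + b) + a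

-- While c < tri (suc d), the truncated difference vanishes exactly when c + 1 reaches
-- the next triangular number, i.e. when c + 1 starts the next diagonal.
diagStep : ℕ → ℕ → ℕ
diagStep c d = ifZero (tri (suc d) ∸ suc c) (suc d) d

diag : ℕ → ℕ
diag zero    = 0
diag (suc c) = diagStep c (diag c)

fst snd : ℕ → ℕ
fst c = c ∸ tri (diag c)
snd c = diag c ∸ fst c

tri-mono-≤ : ∀ {s t} → s ≤ t → tri s ≤ tri t
tri-mono-≤ z≤n     = z≤n
tri-mono-≤ (s≤s p) = +-mono-≤ (tri-mono-≤ p) (s≤s p)

diagStep-bounds : ∀ {c d} → tri d ≤ c → c < tri (suc d) →
                  tri (diagStep c d) ≤ suc c × suc c < tri (suc (diagStep c d))
diagStep-bounds {c} {d} lo hi with tri (suc d) ∸ suc c in eq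
... | zero  =
  ≤-reflexive (sym c+1≡tri) , subst (_< tri (suc (suc d))) (sym c+1≡tri) (m<m+n _ z<s)
  where
  c+1≡tri : suc c ≡ tri (suc d)
  c+1≡tri = ≤-antisym hi (m∸n≡0⇒m≤n eq)
... | suc _ = m≤n⇒m≤1+n lo , m∸n≢0⇒n<m (λ eq′ → 0≢1+n (trans (sym eq′) eq))

diag-bounds : ∀ c → tri (diag c) ≤ c × c < tri (suc (diag c))
diag-bounds zero    = z≤n , z<s
diag-bounds (suc c) = diagStep-bounds (proj₁ (diag-bounds c)) (proj₂ (diag-bounds c))

diag-unique : ∀ {s c} → tri s ≤ c → c < tri (suc s) → diag c ≡ s
diag-unique {s} {c} lo hi = ≤-antisym
  (≮⇒≥ λ s<d → ≤⇒≯ (≤-trans (tri-mono-≤ s<d) (proj₁ (diag-bounds c))) hi)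
  (≮⇒≥ λ d<s → ≤⇒≯ (≤-trans (tri-mono-≤ d<s) lo) (proj₂ (diag-bounds c)))

diag-pair : ∀ a b → diag (pair a b) ≡ a + b
diag-pair a b = diag-unique (m≤m+n _ _) (+-monoʳ-< (tri (a + b)) (s≤s (m≤m+n a b)))

fst-pair : ∀ a b → fst (pair a b) ≡ a
fst-pair a b rewrite diag-pair a b = m+n∸m≡n (tri (a + b)) a

snd-pair : ∀ a b → snd (pair a b) ≡ b
snd-pair a b rewrite fst-pair a b | diag-pair a b = m+n∸m≡n a b

PR-tri : PR₁ tri
PR-tri = pr₁ (IsPR-rec IsPR-zero (IsPR-app₂ PR-+ IsPR-head (IsPR-app₁ PR-suc IsPR-second)) _
                       (λ _ → refl) (λ _ _ → refl))

PR-diag : PR₁ diag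
PR-diag = pr₁ (IsPR-rec IsPR-zero (IsPR-app₂ PR-diagStep IsPR-second IsPR-head) _
                       (λ _ → refl) (λ _ _ → refl))
  where
  PR-diagStep : PR₂ diagStep
  PR-diagStep = pr₂ (IsPR-app₃ PR-ifZero
    (IsPR-app₂ PR-∸ (IsPR-app₁ PR-tri d+1) (IsPR-app₁ PR-suc IsPR-head)) d+1 IsPR-second)
    where
    d+1 : IsPR 2 (λ xs → suc (head (tail xs)))
    d+1 = IsPR-app₁ PR-suc IsPR-second

PR-pair : PR₂ pair
PR-pair = pr₂ (IsPR-app₂ PR-+ (IsPR-app₁ PR-tri (IsPR-app₂ PR-+ IsPR-head IsPR-second)) IsPR-head)

PR-pair-with : ∀ a → PR₁ (pair a)
PR-pair-with a = pr₁ (IsPR-app₂ PR-pair (IsPR-const a) IsPR-head)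

PR-fst : PR₁ fst
PR-fst = pr₁ (IsPR-app₂ PR-∸ IsPR-head (IsPR-app₁ PR-tri (IsPR-app₁ PR-diag IsPR-head)))

PR-snd : PR₁ snd
PR-snd = pr₁ (IsPR-app₂ PR-∸ (IsPR-app₁ PR-diag IsPR-head) (IsPR-app₁ PR-fst IsPR-head))

-- Realizability

SubEnv : Sub m n → Vec ℕ n → Vec ℕ m → Set
SubEnv σ ρ ρ′ = ∀ i → ⟦ σ i ⟧t ρ ≡ lookup ρ′ i

⟦tsub⟧ : (σ : Sub m n) {ρ : Vec ℕ n} {ρ′ : Vec ℕ m} → SubEnv σ ρ ρ′ →
         ∀ t → ⟦ tsub σ t ⟧t ρ ≡ ⟦ t ⟧t ρ′
⟦tsub⟧ σ e (var i)  = e i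
⟦tsub⟧ σ e `0       = refl
⟦tsub⟧ σ e (`S t)   = cong suc (⟦tsub⟧ σ e t)
⟦tsub⟧ σ e (s `+ t) = cong₂ _+_ (⟦tsub⟧ σ e s) (⟦tsub⟧ σ e t)
⟦tsub⟧ σ e (s `· t) = cong₂ _*_ (⟦tsub⟧ σ e s) (⟦tsub⟧ σ e t)

wk₁ : Sub n (suc n)
wk₁ i = var (suc i)

SubEnv-wk : ∀ a (ρ : Vec ℕ n) → SubEnv wk₁ (a ∷ ρ) ρ
SubEnv-wk a ρ i = refl

SubEnv-lift : ∀ {σ : Sub m n} {ρ ρ′ a} → SubEnv σ ρ ρ′ → SubEnv (lift 1 σ) (a ∷ ρ) (a ∷ ρ′)
SubEnv-lift e zero    = refl
SubEnv-lift {σ = σ} {ρ} {a = a} e (suc i) = trans (⟦tsub⟧ wk₁ (SubEnv-wk a ρ) (σ i)) (e i)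

SubEnv-sub1 : ∀ x {t : Tm n} {ρ a} → ⟦ t ⟧t ρ ≡ a → SubEnv (sub1 x t) ρ (ρ [ x ]≔ a)
SubEnv-sub1 x {ρ = ρ} {a} t≡a i with x ≟ i
... | yes refl = trans t≡a (sym (lookup∘update x ρ a))
... | no x≢i   = sym (lookup∘update′ (≢-sym x≢i) ρ a)

infix 4 _⊩_[_]

_⊩_[_] : ℕ → Fm n → Vec ℕ n → Set
r ⊩ s ≐ t [ ρ ]           = ⟦ s ⟧t ρ ≡ ⟦ t ⟧t ρ
r ⊩ ⊤' [ ρ ]              = ⊤
r ⊩ ⊥' [ ρ ]              = ⊥
r ⊩ A ∧' B [ ρ ]          = fst r ⊩ A [ ρ ] × snd r ⊩ B [ ρ ]
r ⊩ A ∨' B [ ρ ]          = fst r ≡ 0 × snd r ⊩ A [ ρ ] ⊎ fst r ≡ 1 × snd r ⊩ B [ ρ ]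
r ⊩ ∃' A [ ρ ]            = snd r ⊩ A [ fst r ∷ ρ ]
r ⊩ ∀'[ k ] A ⇒ B [ ρ ]   = ⊤

⊩-fsub : (σ : Sub m n) {ρ : Vec ℕ n} {ρ′ : Vec ℕ m} → SubEnv σ ρ ρ′ → ∀ A {r} →
         r ⊩ fsub σ A [ ρ ] ⇔ r ⊩ A [ ρ′ ]
⊩-fsub σ e (s ≐ t)         = mk⇔ (subst₂ _≡_ (⟦tsub⟧ σ e s) (⟦tsub⟧ σ e t))
                                 (subst₂ _≡_ (sym (⟦tsub⟧ σ e s)) (sym (⟦tsub⟧ σ e t)))
⊩-fsub σ e ⊤'              = ⇔.refl
⊩-fsub σ e ⊥'              = ⇔.refl
⊩-fsub σ e (A ∧' B)        = ⊩-fsub σ e A ×-⇔ ⊩-fsub σ e B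
⊩-fsub σ e (A ∨' B)        = (⇔.refl ×-⇔ ⊩-fsub σ e A) ⊎-⇔ (⇔.refl ×-⇔ ⊩-fsub σ e B)
⊩-fsub σ e (∃' A)          = ⊩-fsub (lift 1 σ) (SubEnv-lift e) A
⊩-fsub σ e (∀'[ k ] A ⇒ B) = ⇔.refl

⊩-wk : ∀ (A : Fm n) {a ρ r} → r ⊩ wkf 1 A [ a ∷ ρ ] ⇔ r ⊩ A [ ρ ]
⊩-wk A {a} {ρ} = ⊩-fsub wk₁ (SubEnv-wk a ρ) A

module _ {ρ : Vec ℕ n} where

  ⊩-pair : ∀ A B {a b} → a ⊩ A [ ρ ] → b ⊩ B [ ρ ] → pair a b ⊩ A ∧' B [ ρ ]
  ⊩-pair A B {a} {b} pa pb =
    subst (_⊩ A [ ρ ]) (sym (fst-pair a b)) pa , subst (_⊩ B [ ρ ]) (sym (snd-pair a b)) pb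

  ⊩-inj₁ : ∀ A B {t a} → t ≡ 0 → a ⊩ A [ ρ ] → pair t a ⊩ A ∨' B [ ρ ]
  ⊩-inj₁ A B {t} {a} t≡0 pa =
    inj₁ (trans (fst-pair t a) t≡0 , subst (_⊩ A [ ρ ]) (sym (snd-pair t a)) pa)

  ⊩-inj₂ : ∀ A B {t b} → t ≡ 1 → b ⊩ B [ ρ ] → pair t b ⊩ A ∨' B [ ρ ]
  ⊩-inj₂ A B {t} {b} t≡1 pb =
    inj₂ (trans (fst-pair t b) t≡1 , subst (_⊩ B [ ρ ]) (sym (snd-pair t b)) pb)

  ⊩-∃ : ∀ A {a r} → r ⊩ A [ a ∷ ρ ] → pair a r ⊩ ∃' A [ ρ ]
  ⊩-∃ A {a} {r} = subst₂ (λ a′ r′ → r′ ⊩ A [ a′ ∷ ρ ]) (sym (fst-pair a r)) (sym (snd-pair a r))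

true⇒realized : ∀ (A : Fm n) {ρ} → ⟦ A ⟧ ρ → Σ ℕ (_⊩ A [ ρ ])
true⇒realized (s ≐ t)         s≡t = 0 , s≡t
true⇒realized ⊤'              _   = 0 , tt
true⇒realized (A ∧' B)        (a , b) =
  let (r , ra) = true⇒realized A a ; (r′ , rb) = true⇒realized B b in pair r r′ , ⊩-pair A B ra rb
true⇒realized (A ∨' B)        (inj₁ a) =
  let (r , ra) = true⇒realized A a in pair 0 r , ⊩-inj₁ A B refl ra
true⇒realized (A ∨' B)        (inj₂ b) =
  let (r , rb) = true⇒realized B b in pair 1 r , ⊩-inj₂ A B refl rb
true⇒realized (∃' A)          (a , pa) =
  let (r , ra) = true⇒realized A pa in pair a r , ⊩-∃ A ra
true⇒realized (∀'[ k ] A ⇒ B) _        = 0 , tt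

QF⁺-realized⇒true : ∀ {A : Fm n} {ρ r} → QF⁺ A → r ⊩ A [ ρ ] → ⟦ A ⟧ ρ
QF⁺-realized⇒true (q-atom (at-eq s t)) s≡t             = s≡t
QF⁺-realized⇒true (q-atom at-⊤)        _               = tt
QF⁺-realized⇒true (q-atom at-⊥)        ()
QF⁺-realized⇒true (q-∧ qa qb)          (ra , rb)       = QF⁺-realized⇒true qa ra , QF⁺-realized⇒true qb rb
QF⁺-realized⇒true (q-∨ qa qb)          (inj₁ (_ , ra)) = inj₁ (QF⁺-realized⇒true qa ra)
QF⁺-realized⇒true (q-∨ qa qb)          (inj₂ (_ , rb)) = inj₂ (QF⁺-realized⇒true qb rb)

record Realizer (A B : Fm n) : Set where
  field
    fun      : Vec ℕ (suc n) → ℕ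
    isPR     : IsPR (suc n) fun
    realizes : ∀ {ρ r} → r ⊩ A [ ρ ] → fun (r ∷ ρ) ⊩ B [ ρ ]

open Realizer

module _ {A B : Fm n} where

  Realizer-map : {g : ℕ → ℕ} → PR₁ g → (∀ {ρ r} → r ⊩ A [ ρ ] → g r ⊩ B [ ρ ]) → Realizer A B
  Realizer-map {g} pg h = record
    { fun = λ xs → g (head xs) ; isPR = IsPR-app₁ pg IsPR-head ; realizes = h }

  Realizer-const : (∀ {ρ r} → r ⊩ A [ ρ ] → 0 ⊩ B [ ρ ]) → Realizer A B
  Realizer-const = Realizer-map {g = λ _ → 0} (pr₁ IsPR-zero)

module _ {A B C : Fm n} where

  Realizer-trans : Realizer A B → Realizer B C → Realizer A C
  Realizer-trans F G = record
    { fun      = λ xs → fun G (fun F xs ∷ tail xs)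
    ; isPR     = IsPR-∘ {h = λ xs → fun F xs ∷ tail xs} (isPR G) (IsPRs-∷ (isPR F) tail-isPR)
    ; realizes = λ a → realizes G (realizes F a)
    }

  Realizer-∧I : Realizer A B → Realizer A C → Realizer A (B ∧' C)
  Realizer-∧I F G = record
    { fun      = λ xs → pair (fun F xs) (fun G xs)
    ; isPR     = IsPR-app₂ PR-pair (isPR F) (isPR G)
    ; realizes = λ a → ⊩-pair B C (realizes F a) (realizes G a)
    }

  Realizer-∨E : Realizer B A → Realizer C A → Realizer (B ∨' C) A
  Realizer-∨E F G = record
    { fun      = λ xs → ifZero (fst (head xs)) (fun F (payload xs)) (fun G (payload xs))
    ; isPR     = IsPR-app₃ PR-ifZero (IsPR-app₁ PR-fst IsPR-head) (IsPR-∘ (isPR F) payload-isPR)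
                                                                   (IsPR-∘ (isPR G) payload-isPR)
    ; realizes = λ {ρ} → λ where
        (inj₁ (t≡0 , b)) → subst (_⊩ A [ ρ ]) (sym (ifZero-zero t≡0)) (realizes F b)
        (inj₂ (t≡1 , c)) → subst (_⊩ A [ ρ ]) (sym (ifZero-one t≡1)) (realizes G c)
    }
    where
    payload : Vec ℕ (suc n) → Vec ℕ (suc n)
    payload xs = snd (head xs) ∷ tail xs
    payload-isPR : IsPRs (suc n) (suc n) payload
    payload-isPR = IsPRs-∷ (IsPR-app₁ PR-snd IsPR-head) tail-isPR

shuffle : ℕ → ℕ
shuffle r = pair (fst (snd r)) (pair (fst r) (snd (snd r)))

PR-shuffle : PR₁ shuffle
PR-shuffle = pr₁ (IsPR-app₂ PR-pair (IsPR-app₁ PR-fst r₂)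
                                     (IsPR-app₂ PR-pair (IsPR-app₁ PR-fst IsPR-head) (IsPR-app₁ PR-snd r₂)))
  where
  r₂ : IsPR 1 (λ xs → snd (head xs))
  r₂ = IsPR-app₁ PR-snd IsPR-head

module _ {A B C : Fm n} where

  Realizer-dist : Realizer (A ∧' (B ∨' C)) ((A ∧' B) ∨' (A ∧' C))
  Realizer-dist = Realizer-map PR-shuffle λ where
    (a , inj₁ (t≡0 , b)) → ⊩-inj₁ (A ∧' B) (A ∧' C) t≡0 (⊩-pair A B a b)
    (a , inj₂ (t≡1 , c)) → ⊩-inj₂ (A ∧' B) (A ∧' C) t≡1 (⊩-pair A C a c)

module _ {A : Fm n} {B : Fm (suc n)} where

  Realizer-frob : Realizer (A ∧' ∃' B) (∃' (wkf 1 A ∧' B))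
  Realizer-frob = Realizer-map PR-shuffle λ (a , b) →
    ⊩-∃ (wkf 1 A ∧' B) (⊩-pair (wkf 1 A) B (Equivalence.from (⊩-wk A) a) b)

  Realizer-∃E : Realizer B (wkf 1 A) → Realizer (∃' B) A
  Realizer-∃E F = record
    { fun      = λ xs → fun F (snd (head xs) ∷ fst (head xs) ∷ tail xs)
    ; isPR     = IsPR-∘ {h = λ xs → snd (head xs) ∷ fst (head xs) ∷ tail xs} (isPR F)
                   (IsPRs-∷ (IsPR-app₁ PR-snd IsPR-head)
                     (IsPRs-∷ (IsPR-app₁ PR-fst IsPR-head) tail-isPR))
    ; realizes = λ b → Equivalence.to (⊩-wk A) (realizes F b)
    }

  Realizer-∃E⁻ : Realizer (∃' B) A → Realizer B (wkf 1 A)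
  Realizer-∃E⁻ F = record
    { fun      = λ xs → fun F (pair (head (tail xs)) (head xs) ∷ tail (tail xs))
    ; isPR     = IsPR-∘ {h = λ xs → pair (head (tail xs)) (head xs) ∷ tail (tail xs)} (isPR F)
                   (IsPRs-∷ (IsPR-app₂ PR-pair IsPR-second IsPR-head) (λ i → IsPR-∘tail (tail-isPR i)))
    ; realizes = λ { {_ ∷ _} b → Equivalence.from (⊩-wk A) (realizes F (⊩-∃ B b)) }
    }

Realizer-eq : ∀ (x y : Fin n) {A} → Realizer ((var x ≐ var y) ∧' A) (fsub (sub1 x (var y)) A)
Realizer-eq x y {A} = Realizer-map PR-snd λ {ρ} {r} (x≡y , a) →
  Equivalence.from (⊩-fsub (sub1 x (var y)) (SubEnv-sub1 x refl) A)
    (subst (λ ρ′ → snd r ⊩ A [ ρ′ ]) (ρ≡ρ[x≔y] x≡y) a)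
  where
  ρ≡ρ[x≔y] : ∀ {ρ} → lookup ρ x ≡ lookup ρ y → ρ ≡ ρ [ x ]≔ lookup ρ y
  ρ≡ρ[x≔y] {ρ} x≡y = sym (trans (cong (ρ [ x ]≔_) (sym x≡y)) ([]≔-lookup ρ x))

Realizer-subst : ∀ (σ : Sub m n) {A B} → Realizer A B → Realizer (fsub σ A) (fsub σ B)
Realizer-subst {n = n} σ {A} {B} F = record
  { fun      = λ xs → fun F (head xs ∷ ⟦σ⟧ (tail xs))
  ; isPR     = IsPR-∘ {h = λ xs → head xs ∷ ⟦σ⟧ (tail xs)} (isPR F)
                 (IsPRs-∷ IsPR-head λ i →
                   IsPR-cong (λ xs → sym (lookup∘tabulate _ i)) (IsPR-∘tail (IsPR-⟦⟧t (σ i))))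
  ; realizes = λ {ρ} a →
      Equivalence.from (⊩-fsub σ (σ-env ρ) B) (realizes F (Equivalence.to (⊩-fsub σ (σ-env ρ) A) a))
  }
  where
  ⟦σ⟧ : Vec ℕ n → Vec ℕ _
  ⟦σ⟧ ρ = tabulate (λ i → ⟦ σ i ⟧t ρ)
  σ-env : ∀ ρ → SubEnv σ ρ (⟦σ⟧ ρ)
  σ-env ρ i = sym (lookup∘tabulate _ i)

iterate : (Vec ℕ (suc n) → ℕ) → Fin n → ℕ → ℕ → Vec ℕ n → ℕ
iterate f x zero    r ρ = r
iterate f x (suc k) r ρ = f (iterate f x k r ρ ∷ ρ [ x ]≔ k)

Realizer-ind : ∀ (x : Fin n) {A} → Realizer A (fsub (sub1 x (`S (var x))) A) →
               Realizer (fsub (sub1 x `0) A) A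
Realizer-ind {n = n} x {A} F = record
  { fun      = λ xs → iterate (fun F) x (lookup (tail xs) x) (head xs) (tail xs)
  ; isPR     = IsPR-∘ {h = λ xs → lookup (tail xs) x ∷ xs} iterate-isPR
                 (IsPRs-∷ (IsPR-∘tail (IsPR-lookup x)) IsPR-lookup)
  ; realizes = λ {ρ} {r} a₀ →
      subst (λ ρ′ → iterate (fun F) x (lookup ρ x) r ρ ⊩ A [ ρ′ ]) ([]≔-lookup ρ x)
            (iterate-realizes a₀ (lookup ρ x))
  }
  where
  iterate-isPR : IsPR (suc (suc n))
                      (λ ys → iterate (fun F) x (head ys) (head (tail ys)) (tail (tail ys)))
  iterate-isPR = IsPR-rec IsPR-head
    (IsPR-∘ {h = λ zs → head zs ∷ tail (tail (tail zs)) [ x ]≔ head (tail zs)} (isPR F)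
      (IsPRs-∷ IsPR-head (IsPRs-[]≔ x {ρ = λ zs → tail (tail (tail zs))}
        (λ i → IsPR-∘tail (IsPR-∘tail (IsPR-∘tail (IsPR-lookup i)))) IsPR-second)))
    _ (λ _ → refl) (λ _ _ → refl)

  iterate-realizes : ∀ {ρ r} → r ⊩ fsub (sub1 x `0) A [ ρ ] →
                     ∀ k → iterate (fun F) x k r ρ ⊩ A [ ρ [ x ]≔ k ]
  iterate-realizes a₀ zero = Equivalence.to (⊩-fsub (sub1 x `0) (SubEnv-sub1 x refl) A) a₀
  iterate-realizes {ρ} {r} a₀ (suc k) =
    subst (λ ρ′ → iterate (fun F) x (suc k) r ρ ⊩ A [ ρ′ ]) ([]≔-idempotent ρ x)
    (Equivalence.to (⊩-fsub (sub1 x (`S (var x))) (SubEnv-sub1 x (cong suc (lookup∘update x ρ k))) A)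
      (realizes F (iterate-realizes a₀ k)))

realize : {A B : Fm n} → BA A B → Realizer A B
realize ax-id             = Realizer-map (pr₁ IsPR-head) (λ a → a)
realize ax-⊤              = Realizer-const (λ _ → tt)
realize ax-⊥              = Realizer-const (λ ())
realize ax-dist           = Realizer-dist
realize ax-frob           = Realizer-frob
realize (ax-refl x)       = Realizer-const (λ _ → refl)
realize (ax-eq x y _)     = Realizer-eq x y
realize (ax-∀tr k)        = Realizer-const (λ _ → tt)
realize (ax-∀∧ k)         = Realizer-const (λ _ → tt)
realize (ax-∀∨ k)         = Realizer-const (λ _ → tt)
realize (ax-∀sub k m ts)  = Realizer-const (λ _ → tt)
realize (ax-∀∃ m)         = Realizer-const (λ _ → tt)
realize (r-trans p q)     = Realizer-trans (realize p) (realize q)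
realize (r-∧I p q)        = Realizer-∧I (realize p) (realize q)
realize (r-∧E₁ p)         = Realizer-trans (realize p) (Realizer-map PR-fst proj₁)
realize (r-∧E₂ p)         = Realizer-trans (realize p) (Realizer-map PR-snd proj₂)
realize (r-∨E p q)        = Realizer-∨E (realize p) (realize q)
realize (r-∨I₁ {B = B} {C = D} p) =
  Realizer-trans (Realizer-map (PR-pair-with 0) (⊩-inj₁ B D refl)) (realize p)
realize (r-∨I₂ {B = B} {C = D} p) =
  Realizer-trans (Realizer-map (PR-pair-with 1) (⊩-inj₂ B D refl)) (realize p)
realize (r-subst σ p)     = Realizer-subst σ (realize p)
realize (r-∃E p)          = Realizer-∃E (realize p)
realize (r-∃E⁻ p)         = Realizer-∃E⁻ (realize p)
realize (r-→I k p)        = Realizer-const (λ _ → tt)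
realize (ax-S≢0 x)        = Realizer-const (λ ())
realize (ax-Sinj x y)     = Realizer-const suc-injective
realize (ax-+0 x)         = Realizer-const (λ _ → +-identityʳ _)
realize (ax-+S x y)       = Realizer-const (λ _ → +-suc _ _)
realize (ax-·0 x)         = Realizer-const (λ {ρ} _ → *-zeroʳ (lookup ρ x))
realize (ax-·S x y)       = Realizer-const λ {ρ} _ →
  trans (*-suc (lookup ρ x) (lookup ρ y)) (+-comm (lookup ρ x) (lookup ρ x * lookup ρ y))
realize (ax-ind m A)      = Realizer-const (λ _ → tt)
realize (r-ind x p)       = Realizer-ind x (realize p)

-- Erasing universal implications, and prenex ∃₁⁺ forms

eraseImp : Fm n → Fm n
eraseImp (s ≐ t)         = s ≐ t
eraseImp ⊤'              = ⊤'
eraseImp ⊥'              = ⊥'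
eraseImp (A ∧' B)        = eraseImp A ∧' eraseImp B
eraseImp (A ∨' B)        = eraseImp A ∨' eraseImp B
eraseImp (∃' A)          = ∃' (eraseImp A)
eraseImp (∀'[ k ] A ⇒ B) = ⊤'

eraseImp-fsub : ∀ (σ : Sub m n) A → eraseImp (fsub σ A) ≡ fsub σ (eraseImp A)
eraseImp-fsub σ (s ≐ t)         = refl
eraseImp-fsub σ ⊤'              = refl
eraseImp-fsub σ ⊥'              = refl
eraseImp-fsub σ (A ∧' B)        = cong₂ _∧'_ (eraseImp-fsub σ A) (eraseImp-fsub σ B)
eraseImp-fsub σ (A ∨' B)        = cong₂ _∨'_ (eraseImp-fsub σ A) (eraseImp-fsub σ B)
eraseImp-fsub σ (∃' A)          = cong ∃' (eraseImp-fsub (lift 1 σ) A)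
eraseImp-fsub σ (∀'[ k ] A ⇒ B) = refl

⟦⟧-eraseImp : ∀ (A : Fm n) {ρ} → ⟦ A ⟧ ρ → ⟦ eraseImp A ⟧ ρ
⟦⟧-eraseImp (s ≐ t)         p        = p
⟦⟧-eraseImp ⊤'              p        = p
⟦⟧-eraseImp (A ∧' B)        (a , b)  = ⟦⟧-eraseImp A a , ⟦⟧-eraseImp B b
⟦⟧-eraseImp (A ∨' B)        (inj₁ a) = inj₁ (⟦⟧-eraseImp A a)
⟦⟧-eraseImp (A ∨' B)        (inj₂ b) = inj₂ (⟦⟧-eraseImp B b)
⟦⟧-eraseImp (∃' A)          (a , p)  = a , ⟦⟧-eraseImp A p
⟦⟧-eraseImp (∀'[ k ] A ⇒ B) _        = tt

BA-eraseImp : {A B : Fm n} → BA A B → BA (eraseImp A) (eraseImp B)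
BA-eraseImp ax-id                     = ax-id
BA-eraseImp ax-⊤                      = ax-⊤
BA-eraseImp ax-⊥                      = ax-⊥
BA-eraseImp ax-dist                   = ax-dist
BA-eraseImp (ax-frob {A = A} {B})     =
  subst (λ X → BA (eraseImp A ∧' ∃' (eraseImp B)) (∃' (X ∧' eraseImp B)))
        (sym (eraseImp-fsub _ A)) ax-frob
BA-eraseImp (ax-refl x)               = ax-refl x
BA-eraseImp (ax-eq x y (at-eq s t))   = ax-eq x y (at-eq s t)
BA-eraseImp (ax-eq x y at-⊤)          = ax-eq x y at-⊤
BA-eraseImp (ax-eq x y at-⊥)          = ax-eq x y at-⊥
BA-eraseImp (ax-∀tr k)                = ax-⊤
BA-eraseImp (ax-∀∧ k)                 = ax-⊤
BA-eraseImp (ax-∀∨ k)                 = ax-⊤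
BA-eraseImp (ax-∀sub k m ts)          = ax-⊤
BA-eraseImp (ax-∀∃ m)                 = ax-⊤
BA-eraseImp (r-trans p q)             = r-trans (BA-eraseImp p) (BA-eraseImp q)
BA-eraseImp (r-∧I p q)                = r-∧I (BA-eraseImp p) (BA-eraseImp q)
BA-eraseImp (r-∧E₁ p)                 = r-∧E₁ (BA-eraseImp p)
BA-eraseImp (r-∧E₂ p)                 = r-∧E₂ (BA-eraseImp p)
BA-eraseImp (r-∨E p q)                = r-∨E (BA-eraseImp p) (BA-eraseImp q)
BA-eraseImp (r-∨I₁ p)                 = r-∨I₁ (BA-eraseImp p)
BA-eraseImp (r-∨I₂ p)                 = r-∨I₂ (BA-eraseImp p)
BA-eraseImp (r-subst σ {A} {B} p)     =
  subst₂ BA (sym (eraseImp-fsub σ A)) (sym (eraseImp-fsub σ B)) (r-subst σ (BA-eraseImp p))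
BA-eraseImp (r-∃E {A = A} p)          = r-∃E (subst (BA _) (eraseImp-fsub _ A) (BA-eraseImp p))
BA-eraseImp (r-∃E⁻ {A = A} p)         = subst (BA _) (sym (eraseImp-fsub _ A)) (r-∃E⁻ (BA-eraseImp p))
BA-eraseImp (r-→I k p)                = ax-⊤
BA-eraseImp (ax-S≢0 x)                = ax-S≢0 x
BA-eraseImp (ax-Sinj x y)             = ax-Sinj x y
BA-eraseImp (ax-+0 x)                 = ax-+0 x
BA-eraseImp (ax-+S x y)               = ax-+S x y
BA-eraseImp (ax-·0 x)                 = ax-·0 x
BA-eraseImp (ax-·S x y)               = ax-·S x y
BA-eraseImp (ax-ind m A)              = ax-⊤
BA-eraseImp (r-ind x {A} p)           =
  subst (λ X → BA X (eraseImp A)) (sym (eraseImp-fsub _ A))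
        (r-ind x (subst (BA (eraseImp A)) (eraseImp-fsub _ A) (BA-eraseImp p)))

data IsPrenex {n : ℕ} : Fm n → Set where
  qf : ∀ {A} → QF⁺ A → IsPrenex A
  ex : ∀ {A} → IsPrenex A → IsPrenex (∃' A)

QF⁺-fsub : ∀ (σ : Sub m n) {A} → QF⁺ A → QF⁺ (fsub σ A)
QF⁺-fsub σ (q-atom (at-eq s t)) = q-atom (at-eq _ _)
QF⁺-fsub σ (q-atom at-⊤)        = q-atom at-⊤
QF⁺-fsub σ (q-atom at-⊥)        = q-atom at-⊥
QF⁺-fsub σ (q-∧ a b)            = q-∧ (QF⁺-fsub σ a) (QF⁺-fsub σ b)
QF⁺-fsub σ (q-∨ a b)            = q-∨ (QF⁺-fsub σ a) (QF⁺-fsub σ b)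

IsPrenex-fsub : ∀ (σ : Sub m n) {A} → IsPrenex A → IsPrenex (fsub σ A)
IsPrenex-fsub σ (qf q) = qf (QF⁺-fsub σ q)
IsPrenex-fsub σ (ex a) = ex (IsPrenex-fsub (lift 1 σ) a)

IsPrenex-realized⇒true : ∀ {A : Fm n} {ρ r} → IsPrenex A → r ⊩ A [ ρ ] → ⟦ A ⟧ ρ
IsPrenex-realized⇒true (qf q) = QF⁺-realized⇒true q
IsPrenex-realized⇒true (ex a) ra = _ , IsPrenex-realized⇒true a ra

IsPrenex⇒∃₁⁺ : ∀ {A : Fm n} → IsPrenex A → ∃₁⁺ A
IsPrenex⇒∃₁⁺ (qf q) = 0 , _ , q , refl
IsPrenex⇒∃₁⁺ {n} (ex a) with IsPrenex⇒∃₁⁺ a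
... | k , B , q , refl = suc k , subst Fm (+-suc k n) B , QF⁺-subst (+-suc k n) q , ∃ⁿ-suc k B
  where
  QF⁺-subst : ∀ {a b} (a≡b : a ≡ b) {B : Fm a} → QF⁺ B → QF⁺ (subst Fm a≡b B)
  QF⁺-subst refl q = q
  subst-∃ : ∀ {a b} (a≡b : a ≡ b) (B : Fm (suc a)) →
            subst Fm a≡b (∃' B) ≡ ∃' (subst Fm (cong suc a≡b) B)
  subst-∃ refl B = refl
  ∃ⁿ-suc : ∀ {n} k (B : Fm (k + suc n)) → ∃' (∃ⁿ k B) ≡ ∃ⁿ (suc k) (subst Fm (+-suc k n) B)
  ∃ⁿ-suc zero    B = refl
  ∃ⁿ-suc {n} (suc k) B =
    trans (∃ⁿ-suc k (∃' B)) (cong (λ X → ∃ⁿ k (∃' X)) (subst-∃ (+-suc k n) B))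

∧-comm : {A B : Fm n} → BA (A ∧' B) (B ∧' A)
∧-comm = r-∧I (r-∧E₂ ax-id) (r-∧E₁ ax-id)

∧-mono : {A A′ B B′ : Fm n} → BA A A′ → BA B B′ → BA (A ∧' B) (A′ ∧' B′)
∧-mono p q = r-∧I (r-trans (r-∧E₁ ax-id) p) (r-trans (r-∧E₂ ax-id) q)

∨-inj₁ : {A B : Fm n} → BA A (A ∨' B)
∨-inj₁ = r-∨I₁ ax-id

∨-inj₂ : {A B : Fm n} → BA B (A ∨' B)
∨-inj₂ = r-∨I₂ ax-id

∨-comm : {A B : Fm n} → BA (A ∨' B) (B ∨' A)
∨-comm = r-∨E ∨-inj₂ ∨-inj₁

∨-mono : {A A′ B B′ : Fm n} → BA A A′ → BA B B′ → BA (A ∨' B) (A′ ∨' B′)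
∨-mono p q = r-∨E (r-trans p ∨-inj₁) (r-trans q ∨-inj₂)

∃-intro : {A : Fm (suc n)} → BA A (wkf 1 (∃' A))
∃-intro = r-∃E⁻ ax-id

∃-mono : {A B : Fm (suc n)} → BA A B → BA (∃' A) (∃' B)
∃-mono p = r-∃E (r-trans p ∃-intro)

∃-⊤ : BA {n} ⊤' (∃' ⊤')
∃-⊤ {n} = r-subst {m = suc n} (λ _ → `0) {⊤'} {∃' ⊤'} (r-∃E⁻ {A = ∃' ⊤'} ax-id)

frob⁻ : {A : Fm n} {B : Fm (suc n)} → BA (∃' (wkf 1 A ∧' B)) (A ∧' ∃' B)
frob⁻ = r-∃E (r-∧I (r-∧E₁ ax-id) (r-trans (r-∧E₂ ax-id) ∃-intro))

∃-∧ : {A : Fm (suc n)} {B : Fm n} → BA (∃' A ∧' B) (∃' (A ∧' wkf 1 B))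
∃-∧ = r-trans ∧-comm (r-trans ax-frob (∃-mono ∧-comm))

∃-∧⁻ : {A : Fm (suc n)} {B : Fm n} → BA (∃' (A ∧' wkf 1 B)) (∃' A ∧' B)
∃-∧⁻ = r-trans (∃-mono ∧-comm) (r-trans frob⁻ ∧-comm)

∃-∨ : {A : Fm (suc n)} {B : Fm n} → BA (∃' A ∨' B) (∃' (A ∨' wkf 1 B))
∃-∨ = r-∨E (∃-mono ∨-inj₁)
           (r-trans (r-∧I ax-id (r-trans ax-⊤ ∃-⊤)) (r-trans ax-frob (∃-mono (r-trans (r-∧E₁ ax-id) ∨-inj₂))))

∃-∨⁻ : {A : Fm (suc n)} {B : Fm n} → BA (∃' (A ∨' wkf 1 B)) (∃' A ∨' B)
∃-∨⁻ = r-∃E (r-∨E (r-trans ∃-intro ∨-inj₁) ∨-inj₂)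

PrenexForm : Fm n → Set
PrenexForm {n} A = Σ (Fm n) λ W → IsPrenex W × BA A W × BA W A

QF⁺-∧-prenex : ∀ {A B : Fm n} → QF⁺ A → IsPrenex B → PrenexForm (A ∧' B)
QF⁺-∧-prenex qa (qf qb) = _ , qf (q-∧ qa qb) , ax-id , ax-id
QF⁺-∧-prenex qa (ex b) =
  let (W , w , to , from) = QF⁺-∧-prenex (QF⁺-fsub _ qa) b
  in ∃' W , ex w , r-trans ax-frob (∃-mono to) , r-trans (∃-mono from) frob⁻

∧-prenex : ∀ {A B : Fm n} → IsPrenex A → IsPrenex B → PrenexForm (A ∧' B)
∧-prenex (qf qa) b = QF⁺-∧-prenex qa b
∧-prenex (ex a)  b =
  let (W , w , to , from) = ∧-prenex a (IsPrenex-fsub _ b)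
  in ∃' W , ex w , r-trans ∃-∧ (∃-mono to) , r-trans (∃-mono from) ∃-∧⁻

QF⁺-∨-prenex : ∀ {A B : Fm n} → QF⁺ A → IsPrenex B → PrenexForm (A ∨' B)
QF⁺-∨-prenex qa (qf qb) = _ , qf (q-∨ qa qb) , ax-id , ax-id
QF⁺-∨-prenex qa (ex b) =
  let (W , w , to , from) = QF⁺-∨-prenex (QF⁺-fsub _ qa) b
  in ∃' W , ex w , r-trans ∨-comm (r-trans ∃-∨ (∃-mono (r-trans ∨-comm to))) ,
                   r-trans (∃-mono (r-trans from ∨-comm)) (r-trans ∃-∨⁻ ∨-comm)

∨-prenex : ∀ {A B : Fm n} → IsPrenex A → IsPrenex B → PrenexForm (A ∨' B)
∨-prenex (qf qa) b = QF⁺-∨-prenex qa b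
∨-prenex (ex a)  b =
  let (W , w , to , from) = ∨-prenex a (IsPrenex-fsub _ b)
  in ∃' W , ex w , r-trans ∃-∨ (∃-mono to) , r-trans (∃-mono from) ∃-∨⁻

eraseImp-prenex : ∀ (A : Fm n) → PrenexForm (eraseImp A)
eraseImp-prenex (s ≐ t)         = _ , qf (q-atom (at-eq s t)) , ax-id , ax-id
eraseImp-prenex ⊤'              = _ , qf (q-atom at-⊤) , ax-id , ax-id
eraseImp-prenex ⊥'              = _ , qf (q-atom at-⊥) , ax-id , ax-id
eraseImp-prenex (A ∧' B)        =
  let (WA , wa , toA , fromA) = eraseImp-prenex A ; (WB , wb , toB , fromB) = eraseImp-prenex B
      (W , w , to , from) = ∧-prenex wa wb
  in W , w , r-trans (∧-mono toA toB) to , r-trans from (∧-mono fromA fromB)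
eraseImp-prenex (A ∨' B)        =
  let (WA , wa , toA , fromA) = eraseImp-prenex A ; (WB , wb , toB , fromB) = eraseImp-prenex B
      (W , w , to , from) = ∨-prenex wa wb
  in W , w , r-trans (∨-mono toA toB) to , r-trans from (∨-mono fromA fromB)
eraseImp-prenex (∃' A)          =
  let (W , w , to , from) = eraseImp-prenex A in ∃' W , ex w , ∃-mono to , ∃-mono from
eraseImp-prenex (∀'[ k ] A ⇒ B) = _ , qf (q-atom at-⊤) , ax-id , ax-id

SubEnv-σu : ∀ u v (ρ : Vec ℕ n) → SubEnv σu (u ∷ v ∷ ρ) (u ∷ ρ)
SubEnv-σu u v ρ zero    = refl
SubEnv-σu u v ρ (suc i) = refl

SubEnv-σv : ∀ u v (ρ : Vec ℕ n) → SubEnv σv (u ∷ v ∷ ρ) (v ∷ ρ)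
SubEnv-σv u v ρ zero    = refl
SubEnv-σv u v ρ (suc i) = refl

realized⇒graph : ∀ {A : Fm (suc n)} {f : Vec ℕ n → ℕ} → (∀ as → ⟦ A ⟧ (f as ∷ as)) →
                 BA (fsub σu A ∧' fsub σv A) (var zero ≐ var (suc zero)) →
                 ∀ {as b r} → r ⊩ A [ b ∷ as ] → f as ≡ b
realized⇒graph {A = A} {f} graph unique {as} {b} {r} rb =
  let (r′ , rf) = true⇒realized A (graph as) in
  sym (realizes (realize unique) {b ∷ f as ∷ as} {pair r r′}
         (⊩-pair (fsub σu A) (fsub σv A) (Equivalence.from (⊩-fsub σu (SubEnv-σu b (f as) as) A) rb)
                                         (Equivalence.from (⊩-fsub σv (SubEnv-σv b (f as) as) A) rf)))

Defines-realized⇒graph : ∀ {A f} → Defines n A f → ∀ {as b r} → r ⊩ A [ b ∷ as ] → f as ≡ b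
Defines-realized⇒graph {f = f} (sem , _ , unique) =
  realized⇒graph (λ as → Equivalence.from (sem as (f as)) refl) unique

Defines⇒IsPR : ∀ {A f} → Defines n A f → IsPR n f
Defines⇒IsPR defA@(_ , total , _) =
  IsPR-cong (λ as → sym (Defines-realized⇒graph defA (realizes F {as} {0} tt)))
            (IsPR-app₁ PR-fst (IsPR-∘ {h = λ as → 0 ∷ as} (isPR F) (IsPRs-∷ IsPR-zero IsPR-lookup)))
  where
  F = realize total

Defines-eraseImp : ∀ {A f} → Defines n A f → Defines n (eraseImp A) f
Defines-eraseImp {A = A} {f} (sem , total , unique) =
  (λ as b → mk⇔ (λ e → realized⇒graph graph* unique* (proj₂ (true⇒realized (eraseImp A) e)))
                (λ fas≡b → ⟦⟧-eraseImp A (Equivalence.from (sem as b) fas≡b))) ,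
  BA-eraseImp total , unique*
  where
  graph* : ∀ as → ⟦ eraseImp A ⟧ (f as ∷ as)
  graph* as = ⟦⟧-eraseImp A (Equivalence.from (sem as (f as)) refl)
  unique* : BA (fsub σu (eraseImp A) ∧' fsub σv (eraseImp A)) (var zero ≐ var (suc zero))
  unique* = subst₂ (λ X Y → BA (X ∧' Y) _) (eraseImp-fsub σu A) (eraseImp-fsub σv A) (BA-eraseImp unique)

Defines-prenex : ∀ {A W f} → Defines n A f → BA A W → BA W A → IsPrenex W → Defines n W f
Defines-prenex {A = A} {W} defA@(sem , total , unique) A⇒W W⇒A w =
  (λ as b → mk⇔ (λ e → Defines-realized⇒graph defA (realizes (realize W⇒A) (proj₂ (true⇒realized W e))))
                (λ fas≡b → let (r , ra) = true⇒realized A (Equivalence.from (sem as b) fas≡b)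
                           in IsPrenex-realized⇒true w (realizes (realize A⇒W) ra))) ,
  r-trans total (∃-mono A⇒W) ,
  r-trans (∧-mono (r-subst σu W⇒A) (r-subst σv W⇒A)) unique

theorem3p11 : (n : ℕ) (f : Vec ℕ n → ℕ) → InPR-BA n f →
    IsPR n f × (Σ (Fm (suc n)) λ B → ∃₁⁺ B × Defines n B f)
theorem3p11 n f (A , _ , defA) =
  let (W , w , toW , fromW) = eraseImp-prenex A
  in Defines⇒IsPR defA , W , IsPrenex⇒∃₁⁺ w , Defines-prenex (Defines-eraseImp defA) toW fromW w
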